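{- Let $\mathbf{A}$ be a finitely subdirectly irreducible De Morgan monoid. Then the set $[f)=\{x\in A:f\leqslant x\}$ is the union of the interval $[f,f^2]=\{x\in A: f\leqslant x\leqslant f^2\}$ and a chain (totally ordered subset) whose least element is $f^2$; the elements of this chain are exactly the idempotent elements $x$ of $A$ with $f\leqslant x$.
   Context: An involutive (commutative) residuated lattice (IRL) is an algebra $\langle A;\cdot,\wedge,\vee,\neg,e\rangle$ such that $\langle A;\cdot,e\rangle$ is a commutative monoid, $\langle A;\wedge,\vee\rangle$ is a lattice with order $\leqslant$, $\neg\neg x=x$, and $x\cdot y\leqslant z\iff \neg z\cdot y\leqslant\neg x$. Write $f:=\neg e$, $x^2:=x\cdot x$. A De Morgan monoid is an IRL with distributive lattice reduct satisfying $x\leqslant x^2$. An element $a$ is idempotent if $a^2=a$. An algebra is finitely subdirectly irreducible if its identity relation is meet-irreducible in its congruence lattice. -}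

module Defs where

open import Level using (0ℓ)
open import Data.Product using (_×_)
open import Data.Sum using (_⊎_)
open import Relation.Nullary using (¬_)
open import Relation.Binary using (IsEquivalence)
open import Relation.Binary.PropositionalEquality using (_≡_)
open import Algebra.Structures using (IsCommutativeMonoid)
open import Algebra.Lattice.Structures using (IsDistributiveLattice)

record DeMorganMonoid : Set₁ where
  infixl 7 _·_
  infixr 6 _∧_
  infixr 5 _∨_
  infix 4 _≤_
  field
    Carrier : Set
    _·_ : Carrier → Carrier → Carrier
    _∧_ : Carrier → Carrier → Carrier
    _∨_ : Carrier → Carrier → Carrier
    ¬′  : Carrier → Carrier
    e   : Carrier
  _≤_ : Carrier → Carrier → Set
  x ≤ y = x ∧ y ≡ x
  field
    ·-isCommutativeMonoid : IsCommutativeMonoid _≡_ _·_ e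
    isDistributiveLattice : IsDistributiveLattice _≡_ _∨_ _∧_
    ¬-involutive : ∀ x → ¬′ (¬′ x) ≡ x
    residuation-⇒ : ∀ x y z → x · y ≤ z → ¬′ z · y ≤ ¬′ x
    residuation-⇐ : ∀ x y z → ¬′ z · y ≤ ¬′ x → x · y ≤ z
    square-increasing : ∀ x → x ≤ x · x

  f : Carrier
  f = ¬′ e

  _² : Carrier → Carrier
  x ² = x · x

  Idempotent : Carrier → Set
  Idempotent x = x ² ≡ x

  record Congruence : Set₁ where
    field
      R : Carrier → Carrier → Set
      isEquivalence : IsEquivalence R
      ·-cong : ∀ {x x′ y y′} → R x x′ → R y y′ → R (x · y) (x′ · y′)
      ∧-cong : ∀ {x x′ y y′} → R x x′ → R y y′ → R (x ∧ y) (x′ ∧ y′)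
      ∨-cong : ∀ {x x′ y y′} → R x x′ → R y y′ → R (x ∨ y) (x′ ∨ y′)
      ¬-cong : ∀ {x x′} → R x x′ → R (¬′ x) (¬′ x′)

  IsIdentity : Congruence → Set
  IsIdentity θ = ∀ x y → Congruence.R θ x y → x ≡ y

  -- finitely subdirectly irreducible: the identity congruence is
  -- meet-irreducible in Con A (not the top element, i.e. A is nontrivial,
  -- and whenever θ ∩ φ = Δ then θ = Δ or φ = Δ).
  FSI : Set₁
  FSI = ¬ (∀ (x y : Carrier) → x ≡ y)
      × (∀ (θ φ : Congruence) →
           (∀ x y → Congruence.R θ x y → Congruence.R φ x y → x ≡ y) →
           IsIdentity θ ⊎ IsIdentity φ)

module Submission where

open import Defs
open import Level using (0ℓ)
open import Data.Product using (_×_; _,_; proj₂)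
open import Data.Sum using (_⊎_; inj₁; inj₂)
import Data.Sum as Sum
open import Relation.Binary.PropositionalEquality
open import Relation.Binary.Bundles using (Poset)
open import Relation.Binary.Structures using (IsPartialOrder)
open import Algebra.Bundles using (CommutativeMonoid)
open import Algebra.Structures using (IsCommutativeMonoid)
open import Algebra.Lattice.Bundles using (Lattice)
open import Algebra.Lattice.Structures using (IsDistributiveLattice)
import Algebra.Lattice.Properties.Lattice as LatticeProperties
import Relation.Binary.Lattice.Bundles as OrderLattice
import Relation.Binary.Reasoning.PartialOrder as PosetReasoning
import Algebra.Solver.CommutativeMonoid as CommutativeMonoidSolver

module Properties (A : DeMorganMonoid) where
  open DeMorganMonoid A
  open IsCommutativeMonoid ·-isCommutativeMonoid using (assoc; comm; identityˡ; identityʳ)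

  -- The order x ≤ y ⇔ x ∧ y ≡ x is the library's order-theoretic view of
  -- the lattice reduct (which uses x ≡ x ∧ y), so the partial-order and
  -- meet/join facts below are the library's with the equation flipped.
  lattice : Lattice 0ℓ 0ℓ
  lattice = record { isLattice = IsDistributiveLattice.isLattice isDistributiveLattice }

  private
    module O = OrderLattice.Lattice (LatticeProperties.∨-∧-orderTheoreticLattice lattice)

  ≤-isPartialOrder : IsPartialOrder _≡_ _≤_
  ≤-isPartialOrder = record
    { isPreorder = record
      { isEquivalence = isEquivalence
      ; reflexive     = λ { refl → sym O.refl }
      ; trans         = λ p q → sym (O.trans (sym p) (sym q))
      }
    ; antisym = λ p q → O.antisym (sym p) (sym q)
    }

  ≤-poset : Poset 0ℓ 0ℓ 0ℓ
  ≤-poset = record { isPartialOrder = ≤-isPartialOrder }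

  open Poset ≤-poset public using () renaming (refl to ≤-refl; trans to ≤-trans; antisym to ≤-antisym)
  module ≤-Reasoning = PosetReasoning ≤-poset

  x∧y≤x : ∀ x y → x ∧ y ≤ x
  x∧y≤x x y = sym (O.x∧y≤x x y)

  x∧y≤y : ∀ x y → x ∧ y ≤ y
  x∧y≤y x y = sym (O.x∧y≤y x y)

  ∧-greatest : ∀ {x y z} → x ≤ y → x ≤ z → x ≤ y ∧ z
  ∧-greatest p q = sym (O.∧-greatest (sym p) (sym q))

  x≤x∨y : ∀ x y → x ≤ x ∨ y
  x≤x∨y x y = sym (O.x≤x∨y x y)

  y≤x∨y : ∀ x y → y ≤ x ∨ y
  y≤x∨y x y = sym (O.y≤x∨y x y)

  ∨-least : ∀ {x y z} → x ≤ z → y ≤ z → x ∨ y ≤ z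
  ∨-least p q = sym (O.∨-least (sym p) (sym q))

  ¬-antitone : ∀ {x y} → x ≤ y → ¬′ y ≤ ¬′ x
  ¬-antitone {x} {y} x≤y =
    subst (_≤ ¬′ x) (identityʳ (¬′ y))
      (residuation-⇒ x e y (subst (_≤ y) (sym (identityʳ x)) x≤y))

  ¬-reflects : ∀ {x y} → ¬′ x ≤ ¬′ y → y ≤ x
  ¬-reflects {x} {y} p = subst₂ _≤_ (¬-involutive y) (¬-involutive x) (¬-antitone p)

  ¬-swap : ∀ {u v} → v ≤ ¬′ u → u ≤ ¬′ v
  ¬-swap {u} {v} p = subst (_≤ ¬′ v) (¬-involutive u) (¬-antitone p)

  residual⇒ : ∀ {x a z} → x · a ≤ z → x ≤ ¬′ (¬′ z · a)
  residual⇒ {x} {a} {z} p = ¬-swap (residuation-⇒ x a z p)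

  residual⇐ : ∀ {x a z} → x ≤ ¬′ (¬′ z · a) → x · a ≤ z
  residual⇐ {x} {a} {z} p = residuation-⇐ x a z (¬-swap p)

  ¬f≡e : ¬′ f ≡ e
  ¬f≡e = ¬-involutive e

  ¬[¬f·y]≡¬y : ∀ y → ¬′ (¬′ f · y) ≡ ¬′ y
  ¬[¬f·y]≡¬y y = cong ¬′ (trans (cong (_· y) ¬f≡e) (identityˡ y))

  ·≤f⇒≤¬ : ∀ {x y} → x · y ≤ f → x ≤ ¬′ y
  ·≤f⇒≤¬ {x} {y} p = subst (x ≤_) (¬[¬f·y]≡¬y y) (residual⇒ p)

  ≤¬⇒·≤f : ∀ {x y} → x ≤ ¬′ y → x · y ≤ f
  ≤¬⇒·≤f {x} {y} p = residual⇐ (subst (x ≤_) (sym (¬[¬f·y]≡¬y y)) p)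

  ·¬≤f⇒≤ : ∀ {x y} → x · ¬′ y ≤ f → x ≤ y
  ·¬≤f⇒≤ {x} {y} p = subst (x ≤_) (¬-involutive y) (·≤f⇒≤¬ p)

  x·¬x≤f : ∀ x → x · ¬′ x ≤ f
  x·¬x≤f x = ≤¬⇒·≤f (subst (x ≤_) (sym (¬-involutive x)) ≤-refl)

  f≤⇒¬≤e : ∀ {x} → f ≤ x → ¬′ x ≤ e
  f≤⇒¬≤e {x} p = subst (¬′ x ≤_) ¬f≡e (¬-antitone p)

  ·-monoˡ : ∀ {x y a} → x ≤ y → x · a ≤ y · a
  ·-monoˡ x≤y = residual⇐ (≤-trans x≤y (residual⇒ ≤-refl))

  ·-monoʳ : ∀ {x y a} → x ≤ y → a · x ≤ a · y
  ·-monoʳ {x} {y} {a} x≤y = subst₂ _≤_ (comm x a) (comm y a) (·-monoˡ x≤y)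

  ·-mono : ∀ {x x′ y y′} → x ≤ x′ → y ≤ y′ → x · y ≤ x′ · y′
  ·-mono p q = ≤-trans (·-monoˡ p) (·-monoʳ q)

  ·-distribʳ-∨ : ∀ x y a → (x ∨ y) · a ≤ x · a ∨ y · a
  ·-distribʳ-∨ x y a = residual⇐ (∨-least (residual⇒ (x≤x∨y _ _)) (residual⇒ (y≤x∨y _ _)))

  negative⇒idempotent : ∀ {a} → a ≤ e → Idempotent a
  negative⇒idempotent {a} a≤e =
    ≤-antisym (subst (a · a ≤_) (identityʳ a) (·-monoʳ a≤e)) (square-increasing a)

  -- Excluded middle: e ≤ y ∨ ¬y, since ¬(y ∨ ¬y) ≤ y ∧ ¬y ≤ (y ∧ ¬y)² ≤ y · ¬y ≤ f.
  excluded-middle : ∀ y → e ≤ y ∨ ¬′ y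
  excluded-middle y = ¬-reflects (begin
    ¬′ (y ∨ ¬′ y)          ≤⟨ ∧-greatest ¬[y∨¬y]≤y (¬-antitone (x≤x∨y _ _)) ⟩
    y ∧ ¬′ y               ≤⟨ square-increasing (y ∧ ¬′ y) ⟩
    (y ∧ ¬′ y) · (y ∧ ¬′ y) ≤⟨ ·-mono (x∧y≤x _ _) (x∧y≤y _ _) ⟩
    y · ¬′ y               ≤⟨ x·¬x≤f y ⟩
    f                      ∎)
    where
    open ≤-Reasoning
    ¬[y∨¬y]≤y : ¬′ (y ∨ ¬′ y) ≤ y
    ¬[y∨¬y]≤y = subst (¬′ (y ∨ ¬′ y) ≤_) (¬-involutive y) (¬-antitone (y≤x∨y _ _))

  ·-commutativeMonoid : CommutativeMonoid 0ℓ 0ℓ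
  ·-commutativeMonoid = record { isCommutativeMonoid = ·-isCommutativeMonoid }

  open CommutativeMonoidSolver ·-commutativeMonoid using (solve; _⊜_; _⊕_)

  -- For a ≤ e, the relation  x θ y ⇔ a·x ≤ y ∧ a·y ≤ x  is a congruence.
  -- (Reflexivity uses a·x ≤ x, transitivity and compatibility with ·
  -- use a² = a.)
  module NegativeCongruence (a : Carrier) (a≤e : a ≤ e) where
    R : Carrier → Carrier → Set
    R x y = a · x ≤ y × a · y ≤ x

    a·a≡a : a · a ≡ a
    a·a≡a = negative⇒idempotent a≤e

    a·x≤x : ∀ x → a · x ≤ x
    a·x≤x x = subst (a · x ≤_) (identityˡ x) (·-monoˡ a≤e)

    a·-trans : ∀ {x y z} → a · x ≤ y → a · y ≤ z → a · x ≤ z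
    a·-trans {x} {y} {z} p q = begin
      a · x        ≡⟨ cong (_· x) a·a≡a ⟨
      (a · a) · x  ≡⟨ assoc a a x ⟩
      a · (a · x)  ≤⟨ ·-monoʳ p ⟩
      a · y        ≤⟨ q ⟩
      z            ∎
      where open ≤-Reasoning

    a·-distrib-· : ∀ x y → a · (x · y) ≡ (a · x) · (a · y)
    a·-distrib-· x y = begin
      a · (x · y)        ≡⟨ cong (_· (x · y)) a·a≡a ⟨
      (a · a) · (x · y)  ≡⟨ solve 3 (λ a x y → (a ⊕ a) ⊕ (x ⊕ y) ⊜ (a ⊕ x) ⊕ (a ⊕ y)) refl a x y ⟩
      (a · x) · (a · y)  ∎
      where open ≡-Reasoning

    a·-·-cong : ∀ {x x′ y y′} → a · x ≤ x′ → a · y ≤ y′ → a · (x · y) ≤ x′ · y′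
    a·-·-cong {x} {x′} {y} {y′} p q = subst (_≤ x′ · y′) (sym (a·-distrib-· x y)) (·-mono p q)

    a·-∧-cong : ∀ {x x′ y y′} → a · x ≤ x′ → a · y ≤ y′ → a · (x ∧ y) ≤ x′ ∧ y′
    a·-∧-cong p q = ∧-greatest (≤-trans (·-monoʳ (x∧y≤x _ _)) p) (≤-trans (·-monoʳ (x∧y≤y _ _)) q)

    a·-∨-cong : ∀ {x x′ y y′} → a · x ≤ x′ → a · y ≤ y′ → a · (x ∨ y) ≤ x′ ∨ y′
    a·-∨-cong {x} {x′} {y} {y′} p q = begin
      a · (x ∨ y)    ≡⟨ comm a (x ∨ y) ⟩
      (x ∨ y) · a    ≤⟨ ·-distribʳ-∨ x y a ⟩
      x · a ∨ y · a  ≡⟨ cong₂ _∨_ (comm x a) (comm y a) ⟩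
      a · x ∨ a · y  ≤⟨ ∨-least (≤-trans p (x≤x∨y _ _)) (≤-trans q (y≤x∨y _ _)) ⟩
      x′ ∨ y′        ∎
      where open ≤-Reasoning

    a·-¬-cong : ∀ {x x′} → a · x′ ≤ x → a · ¬′ x ≤ ¬′ x′
    a·-¬-cong {x} {x′} p =
      subst (_≤ ¬′ x′) (comm (¬′ x) a) (residuation-⇒ x′ a x (subst (_≤ x) (comm a x′) p))

    θ : Congruence
    θ = record
      { R = R
      ; isEquivalence = record
        { refl  = λ {x} → a·x≤x x , a·x≤x x
        ; sym   = λ (p , q) → q , p
        ; trans = λ (p , q) (p′ , q′) → a·-trans p p′ , a·-trans q′ q
        }
      ; ·-cong = λ (p , q) (p′ , q′) → a·-·-cong p p′ , a·-·-cong q q′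
      ; ∧-cong = λ (p , q) (p′ , q′) → a·-∧-cong p p′ , a·-∧-cong q q′
      ; ∨-cong = λ (p , q) (p′ , q′) → a·-∨-cong p p′ , a·-∨-cong q q′
      ; ¬-cong = λ (p , q) → a·-¬-cong q , a·-¬-cong p
      }

    -- θ identifies a with e; so θ is the identity congruence only if a = e.
    θ-trivial⇒a≡e : IsIdentity θ → a ≡ e
    θ-trivial⇒a≡e θ-trivial =
      θ-trivial a e (subst (_≤ e) (sym a·a≡a) a≤e , subst (_≤ a) (sym (identityʳ a)) ≤-refl)

  -- If e ≤ a ∨ b for negative a, b, then θ_a ∩ θ_b is the identity:
  -- x ≤ (a ∨ b)·x ≤ a·x ∨ b·x ≤ y, and symmetrically y ≤ x.
  θ-meet-trivial : ∀ {a b} (a≤e : a ≤ e) (b≤e : b ≤ e) → e ≤ a ∨ b → ∀ x y →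
    Congruence.R (NegativeCongruence.θ a a≤e) x y →
    Congruence.R (NegativeCongruence.θ b b≤e) x y → x ≡ y
  θ-meet-trivial {a} {b} _ _ e≤a∨b x y (a·x≤y , a·y≤x) (b·x≤y , b·y≤x) =
    ≤-antisym (covered a·x≤y b·x≤y) (covered a·y≤x b·y≤x)
    where
    covered : ∀ {u v} → a · u ≤ v → b · u ≤ v → u ≤ v
    covered {u} {v} p q = begin
      u              ≡⟨ identityˡ u ⟨
      e · u          ≤⟨ ·-monoˡ e≤a∨b ⟩
      (a ∨ b) · u    ≤⟨ ·-distribʳ-∨ a b u ⟩
      a · u ∨ b · u  ≤⟨ ∨-least p q ⟩
      v              ∎
      where open ≤-Reasoning

  -- With g = ¬(x²) ≤ e (so g² = g) one gets x·g ≤ e from f·g·x ≤ x²·g ≤ f,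
  -- and then x³·g = (x·g)·(x²·g) ≤ e·f = f, i.e. x³ ≤ ¬g = x².
  cube≤square : ∀ {x} → f ≤ x → x ² · x ≤ x ²
  cube≤square {x} f≤x = subst (x ² · x ≤_) (¬-involutive (x ²)) (·≤f⇒≤¬ x³·g≤f)
    where
    g = ¬′ (x ²)

    g·g≡g : g · g ≡ g
    g·g≡g = negative⇒idempotent (f≤⇒¬≤e (≤-trans f≤x (square-increasing x)))

    f·g·x≤f : (f · g) · x ≤ f
    f·g·x≤f = begin
      (f · g) · x  ≡⟨ solve 3 (λ f g x → (f ⊕ g) ⊕ x ⊜ (f ⊕ x) ⊕ g) refl f g x ⟩
      (f · x) · g  ≤⟨ ·-monoˡ (·-monoˡ f≤x) ⟩
      x ² · g      ≤⟨ x·¬x≤f (x ²) ⟩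
      f            ∎
      where open ≤-Reasoning

    x·g≤e : x · g ≤ e
    x·g≤e = residuation-⇐ x g e (·≤f⇒≤¬ f·g·x≤f)

    x³·g≤f : (x ² · x) · g ≤ f
    x³·g≤f = begin
      (x ² · x) · g        ≡⟨ cong ((x ² · x) ·_) g·g≡g ⟨
      (x ² · x) · (g · g)  ≡⟨ solve 2 (λ x g → ((x ⊕ x) ⊕ x) ⊕ (g ⊕ g) ⊜ (x ⊕ g) ⊕ ((x ⊕ x) ⊕ g)) refl x g ⟩
      (x · g) · (x ² · g)  ≤⟨ ·-mono x·g≤e (x·¬x≤f (x ²)) ⟩
      e · f                ≡⟨ identityˡ f ⟩
      f                    ∎
      where open ≤-Reasoning

  square-idempotent : ∀ {x} → f ≤ x → Idempotent (x ²)
  square-idempotent {x} f≤x = ≤-antisym x⁴≤x² (square-increasing (x ²))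
    where
    x⁴≤x² : x ² · x ² ≤ x ²
    x⁴≤x² = begin
      x ² · x ²        ≡⟨ assoc (x ²) x x ⟨
      (x ² · x) · x    ≤⟨ ·-monoˡ (cube≤square f≤x) ⟩
      x ² · x          ≤⟨ cube≤square f≤x ⟩
      x ²              ∎
      where open ≤-Reasoning

  -- For idempotent u: (u·¬u)·u = u·¬u ≤ f, so u·¬u ≤ ¬u.
  idempotent⇒·¬≤¬ : ∀ {u} → Idempotent u → u · ¬′ u ≤ ¬′ u
  idempotent⇒·¬≤¬ {u} u²≡u = ·≤f⇒≤¬ (subst (_≤ f) (sym rearranged) (x·¬x≤f u))
    where
    rearranged : (u · ¬′ u) · u ≡ u · ¬′ u
    rearranged = begin
      (u · ¬′ u) · u  ≡⟨ solve 2 (λ u v → (u ⊕ v) ⊕ u ⊜ (u ⊕ u) ⊕ v) refl u (¬′ u) ⟩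
      u ² · ¬′ u      ≡⟨ cong (_· ¬′ u) u²≡u ⟩
      u · ¬′ u        ∎
      where open ≡-Reasoning

  square-f-least : ∀ {x} → f ≤ x → Idempotent x → f ² ≤ x
  square-f-least f≤x x²≡x = subst (f ² ≤_) x²≡x (·-mono f≤x f≤x)

-- Consequences of finite subdirect irreducibility (only meet-irreducibility
-- of the identity congruence is needed).
module FiniteSubdirectIrreducibility (A : DeMorganMonoid) (fsi : DeMorganMonoid.FSI A) where
  open DeMorganMonoid A
  open Properties A
  open IsCommutativeMonoid ·-isCommutativeMonoid using (assoc; identityʳ)
  open IsDistributiveLattice isDistributiveLattice using (∧-distribˡ-∨)
  open CommutativeMonoidSolver ·-commutativeMonoid using (solve; _⊜_; _⊕_)

  -- The negative elements
  -- a = e ∧ y and b = e ∧ ¬y cover e (by excluded middle and distributivity),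
  -- so θ_a ∩ θ_b is the identity; by finite subdirect irreducibility
  -- θ_a or θ_b is the identity, forcing e ∧ y = e or e ∧ ¬y = e.
  e≤⊎≤f : ∀ y → e ≤ y ⊎ y ≤ f
  e≤⊎≤f y with proj₂ fsi (NegativeCongruence.θ a a≤e) (NegativeCongruence.θ b b≤e)
                         (θ-meet-trivial a≤e b≤e e≤a∨b)
    where
    a = e ∧ y
    b = e ∧ ¬′ y
    a≤e = x∧y≤x e y
    b≤e = x∧y≤x e (¬′ y)
    e≤a∨b : e ≤ a ∨ b
    e≤a∨b = subst (e ≤_) (∧-distribˡ-∨ e y (¬′ y)) (∧-greatest ≤-refl (excluded-middle y))
  ... | inj₁ θa-trivial = inj₁ (NegativeCongruence.θ-trivial⇒a≡e (e ∧ y) (x∧y≤x e y) θa-trivial)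
  ... | inj₂ θb-trivial =
    inj₂ (¬-swap (NegativeCongruence.θ-trivial⇒a≡e (e ∧ ¬′ y) (x∧y≤x e (¬′ y)) θb-trivial))

  -- Each x ≥ f lies in [f, f²] or is idempotent, according to the
  -- dichotomy for x²·¬x: if x²·¬x ≤ f then x² ≤ x; if e ≤ x²·¬x then
  -- x ≤ x³·¬x ≤ x²·¬x = (x·¬x)² ≤ f²  (using x³ ≤ x² and (¬x)² = ¬x).
  interval-or-idempotent : ∀ {x} → f ≤ x → x ≤ f ² ⊎ Idempotent x
  interval-or-idempotent {x} f≤x with e≤⊎≤f (x ² · ¬′ x)
  ... | inj₂ x²·¬x≤f = inj₂ (≤-antisym (·¬≤f⇒≤ x²·¬x≤f) (square-increasing x))
  ... | inj₁ e≤x²·¬x = inj₁ (begin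
    x                        ≡⟨ identityʳ x ⟨
    x · e                    ≤⟨ ·-monoʳ e≤x²·¬x ⟩
    x · (x ² · ¬′ x)         ≡⟨ assoc x (x ²) (¬′ x) ⟨
    (x · x ²) · ¬′ x         ≡⟨ cong (_· ¬′ x) (assoc x x x) ⟨
    (x ² · x) · ¬′ x         ≤⟨ ·-monoˡ (cube≤square f≤x) ⟩
    x ² · ¬′ x               ≡⟨ cong (x ² ·_) ¬x·¬x≡¬x ⟨
    x ² · (¬′ x · ¬′ x)      ≡⟨ solve 2 (λ x n → (x ⊕ x) ⊕ (n ⊕ n) ⊜ (x ⊕ n) ⊕ (x ⊕ n)) refl x (¬′ x) ⟩
    (x · ¬′ x) · (x · ¬′ x)  ≤⟨ ·-mono (x·¬x≤f x) (x·¬x≤f x) ⟩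
    f ²                      ∎)
    where
    open ≤-Reasoning
    ¬x·¬x≡¬x : ¬′ x · ¬′ x ≡ ¬′ x
    ¬x·¬x≡¬x = negative⇒idempotent (f≤⇒¬≤e f≤x)

  -- Idempotents above f are comparable.  Unless a·¬b ≤ f (so a ≤ b) or
  -- b·¬a ≤ f (so b ≤ a), both lie above e, whence
  -- e ≤ (a·¬b)·(b·¬a) = (a·¬a)·(b·¬b) ≤ ¬a·¬b ≤ ¬a, i.e. a ≤ f ≤ b.
  idempotents-comparable : ∀ {a b} → f ≤ a → Idempotent a → f ≤ b → Idempotent b →
    a ≤ b ⊎ b ≤ a
  idempotents-comparable {a} {b} f≤a a²≡a f≤b b²≡b with e≤⊎≤f (a · ¬′ b) | e≤⊎≤f (b · ¬′ a)
  ... | inj₂ a·¬b≤f | _             = inj₁ (·¬≤f⇒≤ a·¬b≤f)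
  ... | inj₁ _      | inj₂ b·¬a≤f   = inj₂ (·¬≤f⇒≤ b·¬a≤f)
  ... | inj₁ e≤a·¬b | inj₁ e≤b·¬a   = inj₁ (≤-trans (¬-swap e≤¬a) f≤b)
    where
    open ≤-Reasoning
    e≤¬a : e ≤ ¬′ a
    e≤¬a = begin
      e                            ≡⟨ identityʳ e ⟨
      e · e                        ≤⟨ ·-mono e≤a·¬b e≤b·¬a ⟩
      (a · ¬′ b) · (b · ¬′ a)      ≡⟨ solve 4 (λ a a′ b b′ → (a ⊕ b′) ⊕ (b ⊕ a′) ⊜ (a ⊕ a′) ⊕ (b ⊕ b′)) refl a (¬′ a) b (¬′ b) ⟩
      (a · ¬′ a) · (b · ¬′ b)      ≤⟨ ·-mono (idempotent⇒·¬≤¬ a²≡a) (idempotent⇒·¬≤¬ b²≡b) ⟩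
      ¬′ a · ¬′ b                  ≤⟨ ·-monoʳ (f≤⇒¬≤e f≤b) ⟩
      ¬′ a · e                     ≡⟨ identityʳ (¬′ a) ⟩
      ¬′ a                         ∎

theorem5p16 : (A : DeMorganMonoid) → DeMorganMonoid.FSI A →
    let open DeMorganMonoid A in
    (∀ x → f ≤ x → (f ≤ x × x ≤ f ²) ⊎ (f ≤ x × Idempotent x))
    × (∀ x y → (f ≤ x × Idempotent x) → (f ≤ y × Idempotent y) → x ≤ y ⊎ y ≤ x)
    × (f ≤ f ² × Idempotent (f ²))
    × (∀ x → (f ≤ x × Idempotent x) → f ² ≤ x)
theorem5p16 A fsi =
    (λ x f≤x → Sum.map (f≤x ,_) (f≤x ,_) (interval-or-idempotent f≤x))
  , (λ x y (f≤x , x²≡x) (f≤y , y²≡y) → idempotents-comparable f≤x x²≡x f≤y y²≡y)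
  , (square-increasing f , square-idempotent ≤-refl)
  , (λ x (f≤x , x²≡x) → square-f-least f≤x x²≡x)
  where
  open DeMorganMonoid A
  open Properties A
  open FiniteSubdirectIrreducibility A fsi
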